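{- Let $L\subseteq A^*$ be a language satisfying $\mathcal E_{ab=ba}$, $\mathcal E_{aab=abb}$ and $\mathcal E_{a=a.a}$ for every $a,b\in A$, and let $\mathcal Q=(Q_1,\dots,Q_\ell)$ be a finite colouring of $\mathbb N$ such that for every $a,b\in A$: $\bigcup_{i=1}^\ell A^*\otimes Q_i^2\subseteq E_{L,f_{a,b},f_{b,a}}$, $\bigcup_{i=1}^\ell A^*\otimes Q_i^3\subseteq E_{L,f_{a,a,b},f_{a,b,b}}$, and $\bigcup_{i=1}^\ell L_{Q_i}\otimes Q_i\subseteq E_{L,f_a,f_a.a}$. Then for any words $w,w'\in A^*$ with $w\sim_{\mathcal Q}w'$, we have $w\in L\iff w'\in L$.
   Context: $A$ is a finite alphabet. For $Q\subseteq\mathbb N$, $\langle w,Q\rangle:=\{a\in A:\exists i\in Q, i<|w|, w_i=a\}$; $w\sim_{\mathcal Q}w'$ means $\langle w,Q_i\rangle=\langle w',Q_i\rangle$ for all $i$. A finite colouring of $\mathbb N$ is a family of pairwise disjoint subsets covering $\mathbb N$. $A^*\otimes\mathbb N^n:=\{(w,j_1,\dots,j_n): j_m<|w|\}$, $A^*\otimes Q^n$ its subset with all $j_m\in Q$, $L_{Q}\otimes Q:=\{(w,j)\in A^*\otimes\mathbb N: j\in Q, |w|\in Q\}$. $E_{L,u,v}:=\{x: u(x)\in L\iff v(x)\in L\}$. $w((j_1,\dots,j_m)\to(b_1,\dots,b_m))$ replaces the letter at $j_r$ by $b_r$; $f_{a,b}(w,j_1,j_2):=w((j_1,j_2)\to(a,b))$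 if $j_1\neq j_2$, else $w$; $f_{a,a,b}(w,j_1,j_2,j_3):=w((j_1,j_2,j_3)\to(a,a,b))$ if pairwise distinct, else $w$ (similarly $f_{a,b,b}$); $f_a(w,i):=w(i\to a)$, $(f_a.a)(w,i):=w(i\to a)\,a$. $\beta(S)$ is the set of ultrafilters on $S$, $\beta f(\nu)=\{P: f^{ -1}(P)\in\nu\}$; $L$ satisfies $\gamma_1\leftrightarrow\gamma_2$ iff ($L\in\gamma_1\iff L\in\gamma_2$); $\mathcal E^{p_1,\dots,p_n}_{u=v}$ is the family of equations $\beta u(\nu)\leftrightarrow\beta v(\nu)$ for $\nu\in\beta(A^*\otimes\mathbb N^n)$ with $\beta p_1(\nu)=\dots=\beta p_n(\nu)$; $\mathcal E_{ab=ba}:=\mathcal E^{\pi_1,\pi_2}_{f_{a,b}=f_{b,a}}$, $\mathcal E_{aab=abb}:=\mathcal E^{\pi_1,\pi_2,\pi_3}_{f_{a,a,b}=f_{a,b,b}}$, $\mathcal E_{a=a.a}:=\mathcal E^{\pi,|\cdot|}_{f_a=f_a.a}$ ($\pi_r$ coordinate projections, $\pi(w,i)=i$, $|\cdot|(w,i)=|w|$). -}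

module Defs where

open import Data.Nat using (ℕ; zero; suc; _<_)
open import Data.Nat.Properties using (_≟_)
open import Data.Fin using (Fin; toℕ)
open import Data.List using (List; []; _∷_; length; lookup; _++_; [_])
open import Data.Product using (Σ; _×_; _,_)
open import Data.Sum using (_⊎_)
open import Data.Unit using (⊤)
open import Data.Empty using (⊥)
open import Relation.Nullary using (¬_; yes; no)
open import Relation.Binary.PropositionalEquality using (_≡_)
open import Function.Bundles using (_⇔_)

Word : ℕ → Set
Word k = List (Fin k)

-- A finite colouring of ℕ with ℓ colours: colour class Q_i = { n | c n ≡ i }.
Colouring : ℕ → Set
Colouring ℓ = ℕ → Fin ℓ

-- ⟨ w , Q_i ⟩ membership: a occurs in w at some position of colour i.
InProj : ∀ {k ℓ} → Colouring ℓ → Word k → Fin ℓ → Fin k → Set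
InProj c w i a = Σ (Fin (length w)) λ j → (c (toℕ j) ≡ i) × (lookup w j ≡ a)

SimQ : ∀ {k ℓ} → Colouring ℓ → Word k → Word k → Set
SimQ c w w' = ∀ i a → InProj c w i a ⇔ InProj c w' i a

record T1 (k : ℕ) : Set where
  constructor t1
  field
    w : Word k
    j : ℕ
    j< : j < length w

record T2 (k : ℕ) : Set where
  constructor t2
  field
    w : Word k
    j₁ j₂ : ℕ
    j₁< : j₁ < length w
    j₂< : j₂ < length w

record T3 (k : ℕ) : Set where
  constructor t3
  field
    w : Word k
    j₁ j₂ j₃ : ℕ
    j₁< : j₁ < length w
    j₂< : j₂ < length w
    j₃< : j₃ < length w

-- replace the letter at position i (no-op if out of range)
setAt : ∀ {k} → Word k → ℕ → Fin k → Word k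
setAt []       _       _ = []
setAt (x ∷ xs) zero    b = b ∷ xs
setAt (x ∷ xs) (suc i) b = x ∷ setAt xs i b

f₂ : ∀ {k} → Fin k → Fin k → T2 k → Word k
f₂ a b (t2 w j₁ j₂ _ _) with j₁ ≟ j₂
... | yes _ = w
... | no  _ = setAt (setAt w j₁ a) j₂ b

f₃ : ∀ {k} → Fin k → Fin k → Fin k → T3 k → Word k
f₃ x y z (t3 w j₁ j₂ j₃ _ _ _) with j₁ ≟ j₂ | j₁ ≟ j₃ | j₂ ≟ j₃
... | no _ | no _ | no _ = setAt (setAt (setAt w j₁ x) j₂ y) j₃ z
... | _    | _    | _    = w

fa : ∀ {k} → Fin k → T1 k → Word k
fa a (t1 w i _) = setAt w i a

fa·a : ∀ {k} → Fin k → T1 k → Word k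
fa·a a (t1 w i _) = setAt w i a ++ [ a ]

record IsUltrafilter {S : Set} (ν : (S → Set) → Set) : Set₁ where
  field
    full   : ν (λ _ → ⊤)
    proper : ¬ ν (λ _ → ⊥)
    upward : ∀ {P R : S → Set} → (∀ x → P x → R x) → ν P → ν R
    meet   : ∀ {P R : S → Set} → ν P → ν R → ν (λ x → P x × R x)
    ultra  : ∀ (P : S → Set) → ν P ⊎ ν (λ x → ¬ P x)

Ultrafilter : Set → Set₁
Ultrafilter S = Σ ((S → Set) → Set) IsUltrafilter

β : {S R : Set} → (S → R) → Ultrafilter S → (R → Set) → Set
β f (ν , _) P = ν (λ x → P (f x))

_≐_ : {R : Set} → ((R → Set) → Set) → ((R → Set) → Set) → Set₁
F ≐ G = ∀ P → F P ⇔ G P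

SatEq : {S W : Set} → (W → Set) → Ultrafilter S → (S → W) → (S → W) → Set
SatEq L ν u v = β u ν L ⇔ β v ν L

E-ab=ba : ∀ {k} → (Word k → Set) → Fin k → Fin k → Set₁
E-ab=ba L a b = ∀ (ν : Ultrafilter (T2 _)) →
  β T2.j₁ ν ≐ β T2.j₂ ν → SatEq L ν (f₂ a b) (f₂ b a)

E-aab=abb : ∀ {k} → (Word k → Set) → Fin k → Fin k → Set₁
E-aab=abb L a b = ∀ (ν : Ultrafilter (T3 _)) →
  β T3.j₁ ν ≐ β T3.j₂ ν → β T3.j₂ ν ≐ β T3.j₃ ν →
  SatEq L ν (f₃ a a b) (f₃ a b b)

E-a=a·a : ∀ {k} → (Word k → Set) → Fin k → Set₁
E-a=a·a L a = ∀ (ν : Ultrafilter (T1 _)) →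
  β T1.j ν ≐ β (λ t → length (T1.w t)) ν → SatEq L ν (fa a) (fa·a a)

-- Words with the same colour profile are linked by the three local moves the hypotheses make
-- L-invariant. First pad the shorter word w up to the length of w': the letter a at position |w|
-- of w' already occurs in w at some position j of colour c |w|, so a=a·a at (w, j) appends it.
-- For equal lengths, take a position p with w_p = a ≠ b = w'_p. If a occurs elsewhere in w in the
-- colour of p, then so does b (it occurs in w' there), and aab=abb turns w_p into b. Otherwise a
-- occurs in w' at some r ≠ p of that colour with w_r ≠ a, and ab=ba swaps w_p and w_r. Each move
-- preserves the colour profile and lowers the Hamming distance to w'.
module Submission where

open import Defs
open import Data.Nat using (ℕ; zero; suc; _+_; _<_; _≤_; z≤n; s≤s)
open import Data.Nat.Properties
  using (_≟_; ≤-total; m≤n⇒∃[o]m+o≡n; +-assoc; <-≤-trans; ≤-refl; +-monoˡ-≤; +-monoʳ-≤; +-monoʳ-<; +-identityʳ; m<m+n; suc-injective; anyUpTo?)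
open import Data.Nat.Induction using (<-wellFounded)
open import Data.Fin using (Fin; toℕ) renaming (zero to fzero; suc to fsuc; _≟_ to _≟ᶠ_)
open import Data.List using ([]; _∷_; length; lookup; _++_; [_])
open import Data.List.Properties using (length-++)
open import Data.Maybe using (Maybe; just; nothing)
open import Data.Maybe.Properties using (just-injective) renaming (≡-dec to ≡-dec-Maybe)
open import Data.Product using (∃; _×_; _,_)
open import Data.Sum using (_⊎_; inj₁; inj₂)
open import Data.Empty using (⊥-elim)
open import Induction.WellFounded using (Acc; acc)
open import Relation.Nullary using (¬_; yes; no; Dec; ¬?; _×-dec_)
open import Relation.Binary.PropositionalEquality using (_≡_; _≢_; refl; sym; trans; cong; subst; subst₂; module ≡-Reasoning)
open import Function.Bundles using (_⇔_; mk⇔; Equivalence)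
open import Function.Properties.Equivalence using () renaming (refl to ⇔-refl; sym to ⇔-sym; trans to ⇔-trans)

private
  variable
    k : ℕ
    a x y : Fin k
    u v w : Word k
    m n : ℕ

infixl 9 _!_

_!_ : Word k → ℕ → Maybe (Fin k)
[]       ! _     = nothing
(x ∷ xs) ! zero  = just x
(x ∷ xs) ! suc n = xs ! n

!-functional : ∀ (w : Word k) n → w ! n ≡ just x → w ! n ≡ just y → x ≡ y
!-functional _ _ e e′ = just-injective (trans (sym e) e′)

!-lookup : ∀ (w : Word k) (j : Fin (length w)) → w ! toℕ j ≡ just (lookup w j)
!-lookup (x ∷ w) fzero    = refl
!-lookup (x ∷ w) (fsuc j) = !-lookup w j

!-just⇒lookup : ∀ (w : Word k) n → w ! n ≡ just a → ∃ λ j → toℕ j ≡ n × lookup w j ≡ a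
!-just⇒lookup (x ∷ w) zero    refl = fzero , refl , refl
!-just⇒lookup (x ∷ w) (suc n) e    with !-just⇒lookup w n e
... | j , toℕj≡n , wj≡a = fsuc j , cong suc toℕj≡n , wj≡a

!-just⇒< : ∀ (w : Word k) n → w ! n ≡ just a → n < length w
!-just⇒< (x ∷ w) zero    _ = s≤s z≤n
!-just⇒< (x ∷ w) (suc n) e = s≤s (!-just⇒< w n e)

<⇒!-just : ∀ (w : Word k) n → n < length w → ∃ λ a → w ! n ≡ just a
<⇒!-just (x ∷ w) zero    _         = x , refl
<⇒!-just (x ∷ w) (suc n) (s≤s n<) = <⇒!-just w n n<

setAt-self : ∀ (w : Word k) n → w ! n ≡ just a → setAt w n a ≡ w
setAt-self (x ∷ w) zero    refl = refl
setAt-self (x ∷ w) (suc n) e    = cong (x ∷_) (setAt-self w n e)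

setAt-!-≡ : ∀ (w : Word k) n b → w ! n ≡ just a → setAt w n b ! n ≡ just b
setAt-!-≡ (x ∷ w) zero    b _ = refl
setAt-!-≡ (x ∷ w) (suc n) b e = setAt-!-≡ w n b e

setAt-!-≢ : ∀ (w : Word k) n b → m ≢ n → setAt w n b ! m ≡ w ! m
setAt-!-≢             []      _       _ _   = refl
setAt-!-≢ {m = zero}  (x ∷ w) zero    _ m≢n = ⊥-elim (m≢n refl)
setAt-!-≢ {m = suc m} (x ∷ w) zero    _ _   = refl
setAt-!-≢ {m = zero}  (x ∷ w) (suc n) _ _   = refl
setAt-!-≢ {m = suc m} (x ∷ w) (suc n) b m≢n = setAt-!-≢ w n b (λ m≡n → m≢n (cong suc m≡n))

length-setAt : ∀ (w : Word k) n b → length (setAt w n b) ≡ length w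
length-setAt []      _       _ = refl
length-setAt (x ∷ w) zero    _ = refl
length-setAt (x ∷ w) (suc n) b = cong suc (length-setAt w n b)

++-[]-! : ∀ (w : Word k) a n → w ! n ≡ just x → (w ++ [ a ]) ! n ≡ just x
++-[]-! (y ∷ w) a zero    e = e
++-[]-! (y ∷ w) a (suc n) e = ++-[]-! w a n e

++-[]-!-inv : ∀ (w : Word k) a n → (w ++ [ a ]) ! n ≡ just x → w ! n ≡ just x ⊎ (n ≡ length w × x ≡ a)
++-[]-!-inv []      a zero    refl = inj₂ (refl , refl)
++-[]-!-inv (y ∷ w) a zero    e    = inj₁ e
++-[]-!-inv (y ∷ w) a (suc n) e    with ++-[]-!-inv w a n e
... | inj₁ e′          = inj₁ e′
... | inj₂ (n≡ , x≡a) = inj₂ (cong suc n≡ , x≡a)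

f₂-distinct : ∀ a b (t : T2 k) → T2.j₁ t ≢ T2.j₂ t →
  f₂ a b t ≡ setAt (setAt (T2.w t) (T2.j₁ t) a) (T2.j₂ t) b
f₂-distinct a b (t2 w j₁ j₂ _ _) j₁≢j₂ with j₁ ≟ j₂
... | yes j₁≡j₂ = ⊥-elim (j₁≢j₂ j₁≡j₂)
... | no  _     = refl

f₃-distinct : ∀ a b d (t : T3 k) → T3.j₁ t ≢ T3.j₂ t → T3.j₁ t ≢ T3.j₃ t → T3.j₂ t ≢ T3.j₃ t →
  f₃ a b d t ≡ setAt (setAt (setAt (T3.w t) (T3.j₁ t) a) (T3.j₂ t) b) (T3.j₃ t) d
f₃-distinct a b d (t3 w j₁ j₂ j₃ _ _ _) ≢₁₂ ≢₁₃ ≢₂₃ with j₁ ≟ j₂ | j₁ ≟ j₃ | j₂ ≟ j₃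
... | yes e | _     | _     = ⊥-elim (≢₁₂ e)
... | no _  | yes e | _     = ⊥-elim (≢₁₃ e)
... | no _  | no _  | yes e = ⊥-elim (≢₂₃ e)
... | no _  | no _  | no _  = refl

mismatch : Fin k → Fin k → ℕ
mismatch x y with x ≟ᶠ y
... | yes _ = 0
... | no  _ = 1

mismatch-≡ : ∀ (x : Fin k) → mismatch x x ≡ 0
mismatch-≡ x with x ≟ᶠ x
... | yes _   = refl
... | no  x≢x = ⊥-elim (x≢x refl)

mismatch-≢ : x ≢ y → mismatch x y ≡ 1
mismatch-≢ {x = x} {y} x≢y with x ≟ᶠ y
... | yes x≡y = ⊥-elim (x≢y x≡y)
... | no  _   = refl

mismatch-≤ : ∀ (x y : Fin k) → mismatch x y ≤ 1
mismatch-≤ x y with x ≟ᶠ y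
... | yes _ = z≤n
... | no  _ = s≤s z≤n

hamming : Word k → Word k → ℕ
hamming []      _       = 0
hamming (x ∷ u) []      = 0
hamming (x ∷ u) (y ∷ v) = mismatch x y + hamming u v

hamming-setAt-≤ : ∀ (u v : Word k) p z → u ! p ≡ just x → v ! p ≡ just y → x ≢ y →
  hamming (setAt u p z) v ≤ hamming u v
hamming-setAt-≤ (_ ∷ u) (_ ∷ v) zero    z refl refl x≢y
  rewrite mismatch-≢ x≢y = +-monoˡ-≤ (hamming u v) (mismatch-≤ z _)
hamming-setAt-≤ (x ∷ u) (y ∷ v) (suc p) z eu ev x≢y =
  +-monoʳ-≤ (mismatch x y) (hamming-setAt-≤ u v p z eu ev x≢y)

hamming-setAt-< : ∀ (u v : Word k) p → u ! p ≡ just x → v ! p ≡ just y → x ≢ y →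
  hamming (setAt u p y) v < hamming u v
hamming-setAt-< (_ ∷ u) (y ∷ v) zero    refl refl x≢y
  rewrite mismatch-≢ x≢y | mismatch-≡ y = ≤-refl
hamming-setAt-< (x ∷ u) (y ∷ v) (suc p) eu ev x≢y =
  +-monoʳ-< (mismatch x y) (hamming-setAt-< u v p eu ev x≢y)

record Mismatch (u v : Word k) : Set where
  constructor mkMismatch
  field
    {position}     : ℕ
    {left right}   : Fin k
    left-at        : u ! position ≡ just left
    right-at       : v ! position ≡ just right
    left≢right     : left ≢ right

≡⊎Mismatch : ∀ (u v : Word k) → length u ≡ length v → u ≡ v ⊎ Mismatch u v
≡⊎Mismatch []      []      _ = inj₁ refl
≡⊎Mismatch (x ∷ u) (y ∷ v) e with x ≟ᶠ y
... | no x≢y  = inj₂ (mkMismatch {position = 0} refl refl x≢y)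
... | yes refl with ≡⊎Mismatch u v (suc-injective e)
...   | inj₁ refl                      = inj₁ refl
...   | inj₂ (mkMismatch {p} eu ev ne) = inj₂ (mkMismatch {position = suc p} eu ev ne)

module Occurrences {ℓ : ℕ} (c : Colouring ℓ) where

  Occurs : Word k → Fin ℓ → Fin k → Set
  Occurs u i a = ∃ λ j → u ! j ≡ just a × c j ≡ i

  infix 4 _∼_

  record _∼_ (u v : Word k) : Set where
    constructor mk∼
    field
      occurs⇔ : ∀ i a → Occurs u i a ⇔ Occurs v i a

  open _∼_ public

  ∼-sym : u ∼ v → v ∼ u
  ∼-sym (mk∼ u∼v) = mk∼ λ i a → ⇔-sym (u∼v i a)

  ∼-trans : u ∼ v → v ∼ w → u ∼ w
  ∼-trans (mk∼ u∼v) (mk∼ v∼w) = mk∼ λ i a → ⇔-trans (u∼v i a) (v∼w i a)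

  InProj⇒Occurs : ∀ (u : Word k) {i a} → InProj c u i a → Occurs u i a
  InProj⇒Occurs u (j , cj , uj) = toℕ j , trans (!-lookup u j) (cong just uj) , cj

  Occurs⇒InProj : ∀ (u : Word k) {i a} → Occurs u i a → InProj c u i a
  Occurs⇒InProj u (n , un , cn) with !-just⇒lookup u n un
  ... | j , refl , uj = j , cn , uj

  SimQ⇒∼ : SimQ c u v → u ∼ v
  SimQ⇒∼ {u = u} {v} sim = mk∼ λ i a → mk⇔
    (λ o → InProj⇒Occurs v (Equivalence.to   (sim i a) (Occurs⇒InProj u o)))
    (λ o → InProj⇒Occurs u (Equivalence.from (sim i a) (Occurs⇒InProj v o)))

  Covers : Word k → Word k → Set
  Covers u v = ∀ n {x} → u ! n ≡ just x → Occurs v (c n) x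

  ∼-intro : Covers u v → Covers v u → u ∼ v
  ∼-intro u⊑v v⊑u = mk∼ λ i a → mk⇔ (λ { (n , e , refl) → u⊑v n e }) (λ { (n , e , refl) → v⊑u n e })

  OccursAway : Word k → ℕ → Fin k → Set
  OccursAway u p a = ∃ λ r → r ≢ p × u ! r ≡ just a × c r ≡ c p

  occursAway? : ∀ (u : Word k) p a → Dec (OccursAway u p a)
  occursAway? u p a with anyUpTo? (λ r → ¬? (r ≟ p) ×-dec ≡-dec-Maybe _≟ᶠ_ (u ! r) (just a) ×-dec (c r ≟ᶠ c p)) (length u)
  ... | yes (r , _ , away)            = yes (r , away)
  ... | no ¬away = no λ { (r , r≢p , ur , cr) → ¬away (r , !-just⇒< u r ur , r≢p , ur , cr) }

  setAt-∼ : ∀ (u : Word k) p b → u ! p ≡ just a → OccursAway u p a → Occurs u (c p) b → setAt u p b ∼ u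
  setAt-∼ u p b up (r , r≢p , ur , cr) b∈u = ∼-intro new⊑u u⊑new
    where
    new⊑u : Covers (setAt u p b) u
    new⊑u n e with n ≟ p
    ... | yes refl = subst (Occurs u (c n)) (!-functional (setAt u p b) n (setAt-!-≡ u n b up) e) b∈u
    ... | no  n≢p  = n , trans (sym (setAt-!-≢ u p b n≢p)) e , refl
    u⊑new : Covers u (setAt u p b)
    u⊑new n e with n ≟ p
    ... | yes refl = r , trans (setAt-!-≢ u n b r≢p) (subst (λ z → u ! r ≡ just z) (!-functional u n up e) ur) , cr
    ... | no  n≢p  = n , trans (setAt-!-≢ u p b n≢p) e , refl

  swap-∼ : ∀ (u : Word k) {p r a d} → u ! p ≡ just a → u ! r ≡ just d → p ≢ r → c p ≡ c r →
    setAt (setAt u p d) r a ∼ u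
  swap-∼ u {p} {r} {a} {d} up ur p≢r cp≡cr = ∼-intro swapped⊑u u⊑swapped
    where
    r≢p : r ≢ p
    r≢p r≡p = p≢r (sym r≡p)
    swapped = setAt (setAt u p d) r a
    swapped-r : swapped ! r ≡ just a
    swapped-r = setAt-!-≡ (setAt u p d) r a (trans (setAt-!-≢ u p d r≢p) ur)
    swapped-p : swapped ! p ≡ just d
    swapped-p = trans (setAt-!-≢ (setAt u p d) r a p≢r) (setAt-!-≡ u p d up)
    swapped-other : n ≢ r → n ≢ p → swapped ! n ≡ u ! n
    swapped-other n≢r n≢p = trans (setAt-!-≢ (setAt u p d) r a n≢r) (setAt-!-≢ u p d n≢p)
    swapped⊑u : Covers swapped u
    swapped⊑u n e with n ≟ r | n ≟ p
    ... | yes refl | _        = p , subst (λ z → u ! p ≡ just z) (!-functional swapped n swapped-r e) up , cp≡cr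
    ... | no _     | yes refl = r , subst (λ z → u ! r ≡ just z) (!-functional swapped n swapped-p e) ur , sym cp≡cr
    ... | no n≢r   | no n≢p   = n , trans (sym (swapped-other n≢r n≢p)) e , refl
    u⊑swapped : Covers u swapped
    u⊑swapped n e with n ≟ r | n ≟ p
    ... | yes refl | _        = p , subst (λ z → swapped ! p ≡ just z) (!-functional u n ur e) swapped-p , cp≡cr
    ... | no _     | yes refl = r , subst (λ z → swapped ! r ≡ just z) (!-functional u n up e) swapped-r , sym cp≡cr
    ... | no n≢r   | no n≢p   = n , trans (swapped-other n≢r n≢p) e , refl

  ++-[]-∼ : ∀ (u : Word k) a → Occurs u (c (length u)) a → u ++ [ a ] ∼ u
  ++-[]-∼ u a a∈u = ∼-intro longer⊑u (λ n e → n , ++-[]-! u a n e , refl)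
    where
    longer⊑u : Covers (u ++ [ a ]) u
    longer⊑u n e with ++-[]-!-inv u a n e
    ... | inj₁ e′            = n , e′ , refl
    ... | inj₂ (refl , refl) = a∈u

module Moves {k ℓ : ℕ} (L : Word k → Set) (c : Colouring ℓ)
  (ab=ba : ∀ a b (t : T2 k) → c (T2.j₁ t) ≡ c (T2.j₂ t) → L (f₂ a b t) ⇔ L (f₂ b a t))
  (aab=abb : ∀ a b (t : T3 k) → c (T3.j₁ t) ≡ c (T3.j₂ t) → c (T3.j₂ t) ≡ c (T3.j₃ t) →
    L (f₃ a a b t) ⇔ L (f₃ a b b t))
  (a=a·a : ∀ a (t : T1 k) → c (T1.j t) ≡ c (length (T1.w t)) → L (fa a t) ⇔ L (fa·a a t))
  where

  open Occurrences c

  recolour-⇔ : ∀ (u : Word k) {r p q a b} → u ! r ≡ just a → u ! p ≡ just a → u ! q ≡ just b →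
    r ≢ p → r ≢ q → p ≢ q → c r ≡ c p → c p ≡ c q → L u ⇔ L (setAt u p b)
  recolour-⇔ u {r} {p} {q} {a} {b} ur up uq r≢p r≢q p≢q cr≡cp cp≡cq =
    subst₂ (λ w w′ → L w ⇔ L w′) aab≡u abb≡u′ (aab=abb a b t cr≡cp cp≡cq)
    where
    open ≡-Reasoning
    t = t3 u r p q (!-just⇒< u r ur) (!-just⇒< u p up) (!-just⇒< u q uq)
    aab≡u : f₃ a a b t ≡ u
    aab≡u = begin
      f₃ a a b t                           ≡⟨ f₃-distinct a a b t r≢p r≢q p≢q ⟩
      setAt (setAt (setAt u r a) p a) q b  ≡⟨ cong (λ w → setAt (setAt w p a) q b) (setAt-self u r ur) ⟩
      setAt (setAt u p a) q b              ≡⟨ cong (λ w → setAt w q b) (setAt-self u p up) ⟩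
      setAt u q b                          ≡⟨ setAt-self u q uq ⟩
      u                                    ∎
    abb≡u′ : f₃ a b b t ≡ setAt u p b
    abb≡u′ = begin
      f₃ a b b t                           ≡⟨ f₃-distinct a b b t r≢p r≢q p≢q ⟩
      setAt (setAt (setAt u r a) p b) q b  ≡⟨ cong (λ w → setAt (setAt w p b) q b) (setAt-self u r ur) ⟩
      setAt (setAt u p b) q b              ≡⟨ setAt-self (setAt u p b) q (trans (setAt-!-≢ u p b (λ q≡p → p≢q (sym q≡p))) uq) ⟩
      setAt u p b                          ∎

  swap-⇔ : ∀ (u : Word k) {p r a d} → u ! p ≡ just a → u ! r ≡ just d → p ≢ r → c p ≡ c r →
    L u ⇔ L (setAt (setAt u p d) r a)
  swap-⇔ u {p} {r} {a} {d} up ur p≢r cp≡cr =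
    subst₂ (λ w w′ → L w ⇔ L w′) ad≡u (f₂-distinct d a t p≢r) (ab=ba a d t cp≡cr)
    where
    open ≡-Reasoning
    t = t2 u p r (!-just⇒< u p up) (!-just⇒< u r ur)
    ad≡u : f₂ a d t ≡ u
    ad≡u = begin
      f₂ a d t                 ≡⟨ f₂-distinct a d t p≢r ⟩
      setAt (setAt u p a) r d  ≡⟨ cong (λ w → setAt w r d) (setAt-self u p up) ⟩
      setAt u r d              ≡⟨ setAt-self u r ur ⟩
      u                        ∎

  ++-[]-⇔ : ∀ (u : Word k) {j a} → u ! j ≡ just a → c j ≡ c (length u) → L u ⇔ L (u ++ [ a ])
  ++-[]-⇔ u {j} {a} uj cj≡c|u| =
    subst (λ w → L w ⇔ L (w ++ [ a ])) (setAt-self u j uj) (a=a·a a (t1 u j (!-just⇒< u j uj)) cj≡c|u|)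

  record Closer (u v : Word k) : Set where
    constructor mkCloser
    field
      {next}        : Word k
      L-next        : L u ⇔ L next
      length-next   : length next ≡ length v
      next∼v        : next ∼ v
      hamming-next  : hamming next v < hamming u v

  closer-by-recolour : ∀ {u v : Word k} → length u ≡ length v → u ∼ v → (m : Mismatch u v) →
    OccursAway u (Mismatch.position m) (Mismatch.left m) → Closer u v
  closer-by-recolour {u} {v} e u∼v (mkMismatch {p} {a} {b} up vp a≢b) away@(r , r≢p , ur , cr≡cp)
    with Equivalence.from (occurs⇔ u∼v (c p) b) (p , vp , refl)
  ... | b∈u@(q , uq , cq≡cp) = mkCloser
    (recolour-⇔ u ur up uq r≢p r≢q p≢q cr≡cp (sym cq≡cp))
    (trans (length-setAt u p b) e)
    (∼-trans (setAt-∼ u p b up away b∈u) u∼v)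
    (hamming-setAt-< u v p up vp a≢b)
    where
    p≢q : p ≢ q
    p≢q refl = a≢b (!-functional u p up uq)
    r≢q : r ≢ q
    r≢q refl = a≢b (!-functional u r ur uq)

  closer-by-swap : ∀ {u v : Word k} → length u ≡ length v → u ∼ v → (m : Mismatch u v) →
    ¬ OccursAway u (Mismatch.position m) (Mismatch.left m) → Closer u v
  closer-by-swap {u} {v} e u∼v (mkMismatch {p} {a} {b} up vp a≢b) ¬away
    with Equivalence.to (occurs⇔ u∼v (c p) a) (p , up , refl)
  ... | r , vr , cr≡cp with <⇒!-just u r (subst (r <_) (sym e) (!-just⇒< v r vr))
  ...   | d , ur = mkCloser
    (swap-⇔ u up ur p≢r (sym cr≡cp))
    (trans (length-setAt (setAt u p d) r a) (trans (length-setAt u p d) e))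
    (∼-trans (swap-∼ u up ur p≢r (sym cr≡cp)) u∼v)
    (<-≤-trans (hamming-setAt-< (setAt u p d) v r (trans (setAt-!-≢ u p d r≢p) ur) vr d≢a)
               (hamming-setAt-≤ u v p d up vp a≢b))
    where
    r≢p : r ≢ p
    r≢p refl = a≢b (!-functional v r vr vp)
    p≢r : p ≢ r
    p≢r p≡r = r≢p (sym p≡r)
    d≢a : d ≢ a
    d≢a refl = ¬away (r , r≢p , ur , cr≡cp)

  closer : ∀ {u v : Word k} → length u ≡ length v → u ∼ v → Mismatch u v → Closer u v
  closer {u} e u∼v m with occursAway? u (Mismatch.position m) (Mismatch.left m)
  ... | yes away = closer-by-recolour e u∼v m away
  ... | no ¬away = closer-by-swap e u∼v m ¬away

  equal-length-⇔ : ∀ (u v : Word k) → length u ≡ length v → u ∼ v → Acc _<_ (hamming u v) → L u ⇔ L v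
  equal-length-⇔ u v e u∼v (acc smaller) with ≡⊎Mismatch u v e
  ... | inj₁ refl = ⇔-refl
  ... | inj₂ m with closer e u∼v m
  ...   | mkCloser {u′} L-u′ e′ u′∼v fewer = ⇔-trans L-u′ (equal-length-⇔ u′ v e′ u′∼v (smaller fewer))

  padding-⇔ : ∀ d (u v : Word k) → length u + d ≡ length v → u ∼ v → L u ⇔ L v
  padding-⇔ zero u v e u∼v =
    equal-length-⇔ u v (trans (sym (+-identityʳ (length u))) e) u∼v (<-wellFounded _)
  padding-⇔ (suc d) u v e u∼v with <⇒!-just v (length u) (subst (length u <_) e (m<m+n (length u) (s≤s z≤n)))
  ... | a , va with Equivalence.from (occurs⇔ u∼v (c (length u)) a) (length u , va , refl)
  ...   | a∈u@(j , uj , cj≡c|u|) =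
    ⇔-trans (++-[]-⇔ u uj cj≡c|u|) (padding-⇔ d (u ++ [ a ]) v e′ (∼-trans (++-[]-∼ u a a∈u) u∼v))
    where
    e′ : length (u ++ [ a ]) + d ≡ length v
    e′ = trans (cong (_+ d) (length-++ u)) (trans (+-assoc (length u) 1 d) e)

  ∼⇒⇔ : ∀ {u v : Word k} → u ∼ v → L u ⇔ L v
  ∼⇒⇔ {u} {v} u∼v with ≤-total (length u) (length v)
  ... | inj₁ u≤v = let d , e = m≤n⇒∃[o]m+o≡n u≤v in padding-⇔ d u v e u∼v
  ... | inj₂ v≤u = let d , e = m≤n⇒∃[o]m+o≡n v≤u in ⇔-sym (padding-⇔ d v u e (∼-sym u∼v))

mainTheorem15 : (k ℓ : ℕ) (L : Word k → Set) (c : Colouring ℓ) →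
    (∀ a b → E-ab=ba L a b) →
    (∀ a b → E-aab=abb L a b) →
    (∀ a → E-a=a·a L a) →
    (∀ a b (t : T2 k) → c (T2.j₁ t) ≡ c (T2.j₂ t) →
      L (f₂ a b t) ⇔ L (f₂ b a t)) →
    (∀ a b (t : T3 k) → c (T3.j₁ t) ≡ c (T3.j₂ t) → c (T3.j₂ t) ≡ c (T3.j₃ t) →
      L (f₃ a a b t) ⇔ L (f₃ a b b t)) →
    (∀ a (t : T1 k) → c (T1.j t) ≡ c (length (T1.w t)) →
      L (fa a t) ⇔ L (fa·a a t)) →
    ∀ (w w' : Word k) → SimQ c w w' → L w ⇔ L w'
mainTheorem15 k ℓ L c _ _ _ ab=ba aab=abb a=a·a w w′ w∼w′ =
  Moves.∼⇒⇔ L c ab=ba aab=abb a=a·a (Occurrences.SimQ⇒∼ c w∼w′)
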